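{- Let $q$ be a prime power with $q\equiv 5\pmod 8$ and consider the directed graph $\mathcal{J}_{\mathbb{F}_q}$ defined below. Then every directed cycle in $\mathcal{J}_{\mathbb{F}_q}$ has more than two vertices.
   Context: $\mathbb{F}_q$ is the finite field with $q$ elements. $\phi_q\colon \mathbb{F}_q^\times\to\{\pm1\}$ is the quadratic character: $\phi_q(a)=1$ if $a$ is a square in $\mathbb{F}_q^\times$ and $-1$ otherwise. The directed graph $\mathcal{J}_{\mathbb{F}_q}=(V,E)$ has vertex set $V=\{(a,b)\in(\mathbb{F}_q^\times)^2 : \phi_q(ab)=1,\ a\neq \pm b\}$, and for $(a,b),(c,d)\in V$ there is an edge $(a,b)\to(c,d)$ if and only if $c=\frac{a+b}{2}$ and $d^2=ab$. -}

module Defs where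

open import Level using (Level; suc; _⊔_)
open import Data.Nat using (ℕ; NonZero) renaming (suc to sucℕ)
open import Data.Nat.DivMod using (_mod_)
open import Data.Fin using (Fin; toℕ)
open import Data.Product using (Σ; ∃; _×_; _,_; proj₁; proj₂)
open import Relation.Binary.PropositionalEquality using (_≡_)
open import Relation.Nullary using (¬_)
open import Algebra.Structures using (IsCommutativeRing)
open import Function.Bundles using (_↔_)

record Field (ℓ : Level) : Set (suc ℓ) where
  infixl 7 _*_
  infixl 6 _+_
  field
    Carrier : Set ℓ
    _+_ _*_ : Carrier → Carrier → Carrier
    -_ : Carrier → Carrier
    0# 1# : Carrier
    isCommutativeRing : IsCommutativeRing _≡_ _+_ _*_ -_ 0# 1#
    0≢1 : ¬ (0# ≡ 1#)
    inverse : ∀ x → ¬ (x ≡ 0#) → Σ Carrier (λ y → x * y ≡ 1#)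

HasCardinality : ∀ {ℓ} → Field ℓ → ℕ → Set ℓ
HasCardinality F q = Field.Carrier F ↔ Fin q

module JGraph {ℓ} (F : Field ℓ) where
  open Field F

  2# : Carrier
  2# = 1# + 1#

  -- a is a square in F^×  (for nonzero a): φ_q(a) = 1
  IsSquare : Carrier → Set ℓ
  IsSquare a = Σ Carrier (λ x → x * x ≡ a)

  IsVertex : Carrier × Carrier → Set ℓ
  IsVertex (a , b) =
    ¬ (a ≡ 0#) × ¬ (b ≡ 0#) × IsSquare (a * b) × ¬ (a ≡ b) × ¬ (a ≡ - b)

  -- edge (a,b) → (c,d):  c = (a+b)/2 (written 2c = a+b, 2 being invertible) and d² = ab
  Edge : Carrier × Carrier → Carrier × Carrier → Set ℓ
  Edge (a , b) (c , d) = (2# * c ≡ a + b) × (d * d ≡ a * b)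

  csuc : ∀ {m} → Fin (sucℕ m) → Fin (sucℕ m)
  csuc {m} i = sucℕ (toℕ i) mod sucℕ m

  record DirectedCycle (m : ℕ) : Set ℓ where
    field
      vertex   : Fin (sucℕ m) → Carrier × Carrier
      inV      : ∀ i → IsVertex (vertex i)
      distinct : ∀ i j → vertex i ≡ vertex j → i ≡ j
      edge     : ∀ i → Edge (vertex i) (vertex (csuc i))

-- A 1-cycle (a , b) → (a , b) forces 2a = a + b, i.e. a = b.  For a 2-cycle
-- (a , b) → (c , d) → (a , b), eliminating c gives 2d + b = 3a; squaring and
-- using d² = ab yields (b − a)(b − 9a) = 0, so b = 9a, and then b² = cd turns
-- into 384 a² = 0 with 384 = 2⁷ · 3.  In a field this needs 2 = 0 (excluded
-- since a ≠ −b) or 3 = 0 (excluded since b = 9a ≠ 0).  The argument works over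
-- every field.
module Submission where

open import Defs
open import Level using (Level)
open import Data.Nat using (ℕ; _<_; _%_; suc; zero; s≤s; z≤n)
open import Data.Fin using () renaming (zero to fzero; suc to fsuc)
open import Data.Product using (_,_)
open import Data.Empty using (⊥; ⊥-elim)
open import Relation.Nullary using (¬_)
open import Relation.Binary.PropositionalEquality
  using (_≡_; refl; sym; trans; cong; cong₂; module ≡-Reasoning)
open import Algebra.Bundles using (CommutativeRing)
import Algebra.Properties.Group as GroupProperties
import Algebra.Properties.Semiring.Mult.TCOptimised as SemiringMult
import Algebra.Solver.Ring.NaturalCoefficients.Default as NatSolver

module FieldProperties {ℓ} (F : Field ℓ) where
  open Field F
  open ≡-Reasoning

  ring : CommutativeRing ℓ ℓ
  ring = record { isCommutativeRing = isCommutativeRing }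

  open CommutativeRing ring using (commutativeSemiring; semiring; +-group; *-assoc; *-identityʳ; -‿inverseʳ)
  open CommutativeRing ring public using (zeroˡ; zeroʳ)
  open GroupProperties +-group using (∙-cancelʳ; inverseˡ-unique)
  open NatSolver commutativeSemiring public
  open SemiringMult semiring using (_×_)

  -- The solver's con n evaluates to ι n, and ι 2 is definitionally 2#.
  ι : ℕ → Carrier
  ι n = n × 1#

  +-cancelʳ : ∀ {x y} z → x + z ≡ y + z → x ≡ y
  +-cancelʳ {x} {y} z = ∙-cancelʳ z x y

  x+y≡0⇒x≡-y : ∀ {x y} → x + y ≡ 0# → x ≡ - y
  x+y≡0⇒x≡-y {x} {y} = inverseˡ-unique x y

  *-cancelʳ-≢0 : ∀ {x y} k → ¬ k ≡ 0# → x * k ≡ y * k → x ≡ y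
  *-cancelʳ-≢0 {x} {y} k k≢0 xk≡yk with inverse k k≢0
  ... | k⁻¹ , kk⁻¹≡1 = begin
    x                ≡⟨ sym (*-identityʳ x) ⟩
    x * 1#           ≡⟨ cong (x *_) (sym kk⁻¹≡1) ⟩
    x * (k * k⁻¹)    ≡⟨ sym (*-assoc x k k⁻¹) ⟩
    (x * k) * k⁻¹    ≡⟨ cong (_* k⁻¹) xk≡yk ⟩
    (y * k) * k⁻¹    ≡⟨ *-assoc y k k⁻¹ ⟩
    y * (k * k⁻¹)    ≡⟨ cong (y *_) kk⁻¹≡1 ⟩
    y * 1#           ≡⟨ *-identityʳ y ⟩
    y                ∎

  x*y≢0 : ∀ {x y} → ¬ x ≡ 0# → ¬ y ≡ 0# → ¬ x * y ≡ 0#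
  x*y≢0 {x} {y} x≢0 y≢0 xy≡0 = x≢0 (*-cancelʳ-≢0 y y≢0 (trans xy≡0 (sym (zeroˡ y))))

  384≢0 : ¬ ι 2 ≡ 0# → ¬ ι 3 ≡ 0# → ¬ ι 384 ≡ 0#
  384≢0 2≢0 3≢0 384≡0 = 2⁷·3≢0 (trans (sym 384≡2⁷·3) 384≡0)
    where
    2⁷·3≢0 : ¬ ι 2 * (ι 2 * (ι 2 * (ι 2 * (ι 2 * (ι 2 * (ι 2 * ι 3)))))) ≡ 0#
    2⁷·3≢0 = x*y≢0 2≢0 (x*y≢0 2≢0 (x*y≢0 2≢0 (x*y≢0 2≢0 (x*y≢0 2≢0 (x*y≢0 2≢0 (x*y≢0 2≢0 3≢0))))))
    384≡2⁷·3 : ι 384 ≡ ι 2 * (ι 2 * (ι 2 * (ι 2 * (ι 2 * (ι 2 * (ι 2 * ι 3))))))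
    384≡2⁷·3 = solve 0 (con 384 := con 2 :* (con 2 :* (con 2 :* (con 2 :* (con 2 :* (con 2 :* (con 2 :* con 3))))))) refl

  -- The hypothesis says (u − b)(a − b) = 0.
  u*a+b*b≡u*b+b*a⇒u≡b : ∀ {u a b} → u * a + b * b ≡ u * b + b * a → ¬ a ≡ b → u ≡ b
  u*a+b*b≡u*b+b*a⇒u≡b {u} {a} {b} eq a≢b =
    *-cancelʳ-≢0 (a + - b) a-b≢0 (+-cancelʳ (u * b + b * b) (begin
      u * (a + - b) + (u * b + b * b)
        ≡⟨ solve 4 (λ u a b b′ → u :* (a :+ b′) :+ (u :* b :+ b :* b)
                              := (u :* a :+ b :* b) :+ u :* (b :+ b′)) refl u a b (- b) ⟩
      (u * a + b * b) + u * (b + - b)  ≡⟨ cong₂ (λ s t → s + u * t) eq b-b≡0 ⟩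
      (u * b + b * a) + u * 0#         ≡⟨ cong ((u * b + b * a) +_) (trans (zeroʳ u) (sym (zeroʳ b))) ⟩
      (u * b + b * a) + b * 0#         ≡⟨ cong (λ t → (u * b + b * a) + b * t) (sym b-b≡0) ⟩
      (u * b + b * a) + b * (b + - b)
        ≡⟨ solve 4 (λ u a b b′ → (u :* b :+ b :* a) :+ b :* (b :+ b′)
                              := b :* (a :+ b′) :+ (u :* b :+ b :* b)) refl u a b (- b) ⟩
      b * (a + - b) + (u * b + b * b)  ∎))
    where
    b-b≡0 : b + - b ≡ 0#
    b-b≡0 = -‿inverseʳ b
    a-b≢0 : ¬ a + - b ≡ 0#
    a-b≢0 a-b≡0 = a≢b (+-cancelʳ (- b) (trans a-b≡0 (sym b-b≡0)))

module JGraphProperties {ℓ} (F : Field ℓ) where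
  open Field F
  open FieldProperties F
  open JGraph F
  open ≡-Reasoning

  loop⇒≡ : ∀ {a b} → Edge (a , b) (a , b) → a ≡ b
  loop⇒≡ {a} {b} (2a≡a+b , _) = +-cancelʳ a (begin
    a + a      ≡⟨ solve 1 (λ a → a :+ a := con 2 :* a) refl a ⟩
    ι 2 * a    ≡⟨ 2a≡a+b ⟩
    a + b      ≡⟨ solve 2 (λ a b → a :+ b := b :+ a) refl a b ⟩
    b + a      ∎)

  no-loop : ∀ {v} → IsVertex v → ¬ Edge v v
  no-loop (_ , _ , _ , a≢b , _) loop = a≢b (loop⇒≡ loop)

  module TwoCycle {a b c d}
    (2c≡a+b : ι 2 * c ≡ a + b) (d²≡ab : d * d ≡ a * b)
    (2a≡c+d : ι 2 * a ≡ c + d) (b²≡cd : b * b ≡ c * d) where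

    2d+b≡3a : ι 2 * d + b ≡ ι 3 * a
    2d+b≡3a = +-cancelʳ a (begin
      (ι 2 * d + b) + a  ≡⟨ solve 3 (λ a b d → (con 2 :* d :+ b) :+ a := con 2 :* d :+ (a :+ b)) refl a b d ⟩
      ι 2 * d + (a + b)  ≡⟨ cong (ι 2 * d +_) (sym 2c≡a+b) ⟩
      ι 2 * d + ι 2 * c  ≡⟨ solve 2 (λ c d → con 2 :* d :+ con 2 :* c := con 2 :* (c :+ d)) refl c d ⟩
      ι 2 * (c + d)      ≡⟨ cong (ι 2 *_) (sym 2a≡c+d) ⟩
      ι 2 * (ι 2 * a)    ≡⟨ solve 1 (λ a → con 2 :* (con 2 :* a) := con 3 :* a :+ a) refl a ⟩
      ι 3 * a + a        ∎)

    -- (2d + b)² + b² = 4d² + 2b(2d + b), evaluated with 2d + b = 3a and d² = ab.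
    9a·a+b·b≡9a·b+b·a : ι 9 * a * a + b * b ≡ ι 9 * a * b + b * a
    9a·a+b·b≡9a·b+b·a = begin
      ι 9 * a * a + b * b
        ≡⟨ solve 2 (λ a b → con 9 :* a :* a :+ b :* b := (con 3 :* a) :* (con 3 :* a) :+ b :* b) refl a b ⟩
      (ι 3 * a) * (ι 3 * a) + b * b
        ≡⟨ cong (λ t → t * t + b * b) (sym 2d+b≡3a) ⟩
      (ι 2 * d + b) * (ι 2 * d + b) + b * b
        ≡⟨ solve 2 (λ b d → (con 2 :* d :+ b) :* (con 2 :* d :+ b) :+ b :* b
                          := con 4 :* (d :* d) :+ con 2 :* b :* (con 2 :* d :+ b)) refl b d ⟩
      ι 4 * (d * d) + ι 2 * b * (ι 2 * d + b)
        ≡⟨ cong₂ (λ s t → ι 4 * s + ι 2 * b * t) d²≡ab 2d+b≡3a ⟩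
      ι 4 * (a * b) + ι 2 * b * (ι 3 * a)
        ≡⟨ solve 2 (λ a b → con 4 :* (a :* b) :+ con 2 :* b :* (con 3 :* a)
                          := con 9 :* a :* b :+ b :* a) refl a b ⟩
      ι 9 * a * b + b * a ∎

    a≢b⇒b≡9a : ¬ a ≡ b → b ≡ ι 9 * a
    a≢b⇒b≡9a a≢b = sym (u*a+b*b≡u*b+b*a⇒u≡b 9a·a+b·b≡9a·b+b·a a≢b)

    module _ (b≡9a : b ≡ ι 9 * a) where

      2d+6a≡0 : ι 2 * d + ι 6 * a ≡ 0#
      2d+6a≡0 = +-cancelʳ (ι 3 * a) (begin
        ι 2 * d + ι 6 * a + ι 3 * a
          ≡⟨ solve 2 (λ a d → con 2 :* d :+ con 6 :* a :+ con 3 :* a := con 2 :* d :+ con 9 :* a) refl a d ⟩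
        ι 2 * d + ι 9 * a  ≡⟨ cong (ι 2 * d +_) (sym b≡9a) ⟩
        ι 2 * d + b        ≡⟨ 2d+b≡3a ⟩
        ι 3 * a            ≡⟨ solve 1 (λ a → con 3 :* a := con 0 :+ con 3 :* a) refl a ⟩
        0# + ι 3 * a       ∎)

      384a²≡0 : ι 384 * (a * a) ≡ 0#
      384a²≡0 = begin
        ι 384 * (a * a)
          ≡⟨ solve 1 (λ a → con 384 :* (a :* a)
                          := con 4 :* ((con 9 :* a) :* (con 9 :* a)) :+ con 6 :* a :* (a :+ con 9 :* a)) refl a ⟩
        ι 4 * ((ι 9 * a) * (ι 9 * a)) + ι 6 * a * (a + ι 9 * a)
          ≡⟨ cong (λ t → ι 4 * (t * t) + ι 6 * a * (a + t)) (sym b≡9a) ⟩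
        ι 4 * (b * b) + ι 6 * a * (a + b)
          ≡⟨ cong (λ t → ι 4 * t + ι 6 * a * (a + b)) b²≡cd ⟩
        ι 4 * (c * d) + ι 6 * a * (a + b)
          ≡⟨ solve 4 (λ a b c d → con 4 :* (c :* d) :+ con 6 :* a :* (a :+ b)
                                := (con 2 :* c) :* (con 2 :* d) :+ con 6 :* a :* (a :+ b)) refl a b c d ⟩
        (ι 2 * c) * (ι 2 * d) + ι 6 * a * (a + b)
          ≡⟨ cong (λ t → t * (ι 2 * d) + ι 6 * a * (a + b)) 2c≡a+b ⟩
        (a + b) * (ι 2 * d) + ι 6 * a * (a + b)
          ≡⟨ solve 3 (λ a b d → (a :+ b) :* (con 2 :* d) :+ con 6 :* a :* (a :+ b)
                              := (a :+ b) :* (con 2 :* d :+ con 6 :* a)) refl a b d ⟩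
        (a + b) * (ι 2 * d + ι 6 * a)
          ≡⟨ cong ((a + b) *_) 2d+6a≡0 ⟩
        (a + b) * 0#
          ≡⟨ zeroʳ (a + b) ⟩
        0# ∎

  no-2-cycle : ∀ {v w} → IsVertex v → Edge v w → Edge w v → ⊥
  no-2-cycle {a , b} {c , d} (a≢0 , b≢0 , _ , a≢b , a≢-b) (2c≡a+b , d²≡ab) (2a≡c+d , b²≡cd) =
    x*y≢0 (384≢0 2≢0 3≢0) (x*y≢0 a≢0 a≢0) (384a²≡0 b≡9a)
    where
    open TwoCycle 2c≡a+b d²≡ab 2a≡c+d b²≡cd
    b≡9a : b ≡ ι 9 * a
    b≡9a = a≢b⇒b≡9a a≢b
    2≢0 : ¬ ι 2 ≡ 0#
    2≢0 2≡0 = a≢-b (x+y≡0⇒x≡-y (begin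
      a + b     ≡⟨ sym 2c≡a+b ⟩
      ι 2 * c   ≡⟨ cong (_* c) 2≡0 ⟩
      0# * c    ≡⟨ zeroˡ c ⟩
      0#        ∎))
    3≢0 : ¬ ι 3 ≡ 0#
    3≢0 3≡0 = b≢0 (begin
      b                ≡⟨ b≡9a ⟩
      ι 9 * a          ≡⟨ solve 1 (λ a → con 9 :* a := con 3 :* (con 3 :* a)) refl a ⟩
      ι 3 * (ι 3 * a)  ≡⟨ cong (_* (ι 3 * a)) 3≡0 ⟩
      0# * (ι 3 * a)   ≡⟨ zeroˡ (ι 3 * a) ⟩
      0#               ∎)

-- For m ≤ 1 the cyclic successor csuc computes, so edge gives a loop or a 2-cycle directly.
theorem5p4 : ∀ {ℓ : Level} (F : Field ℓ) (q : ℕ) → HasCardinality F q → q % 8 ≡ 5 →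
    ∀ (m : ℕ) → JGraph.DirectedCycle F m → 2 < suc m
theorem5p4 F _ _ _ zero cycle = ⊥-elim (no-loop (inV fzero) (edge fzero))
  where
  open JGraph.DirectedCycle cycle
  open JGraphProperties F
theorem5p4 F _ _ _ (suc zero) cycle = ⊥-elim (no-2-cycle (inV fzero) (edge fzero) (edge (fsuc fzero)))
  where
  open JGraph.DirectedCycle cycle
  open JGraphProperties F
theorem5p4 F _ _ _ (suc (suc m)) _ = s≤s (s≤s (s≤s z≤n))
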